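{- Let $\mathcal{T}=(\mathcal{S},\to)$ be an LTS, $V$ a valuation, $S\subseteq\mathcal{S}$ and $\Phi$ a fixpoint-free formula (containing no subformula of form $\nu Z.\Psi$ or $\mu Z.\Psi$) such that $S\vdash_\epsilon\Phi$ is a sequent and $S\subseteq[\![\Phi]\!]_V$. Then there is a successful tableau in tableau normal form whose root is labeled $S\vdash_\epsilon\Phi$.
   Context: Fix a set $\Sigma$ and a countably infinite set $\mathrm{Var}$. An LTS is $(\mathcal{S},\to)$, $\to\subseteq\mathcal{S}\times\Sigma\times\mathcal{S}$; $s\xrightarrow{K}s'$ means some $a\in K$ with $(s,a,s')\in\to$. Formulas: $Z\mid\neg\Phi\mid\Phi\wedge\Phi\mid[K]\Phi\mid\nu Z.\Phi$ with bound variables positive; derived $\vee$, $\langle K\rangle\Phi=\neg[K]\neg\Phi$, $\mu Z.\Phi=\neg\nu Z.\neg\Phi[Z:=\neg Z]$; positive normal form: built from $Z,\neg Z,\wedge,\vee,[K],\langle K\rangle,\nu,\mu$. Standard semantics $[\![\cdot]\!]_V$ for valuation $V\colon\mathrm{Var}\to2^{\mathcal{S}}$ ($[K]$: all $K$-successors satisfy; $\nu$: greatest fixpoint). Definition list $\Delta=(U_1=\Phi_1)\cdots(U_n=\Phi_n)$ (distinct $U_i$, none bound in any $\Phi_j$, $U_j$ not free in $\Phi_i$ for $i\le j$); $\epsilon$ empty; $V[\epsilon]=V$, $V[(U=\Phi)\cdot\Delta']=(V[U:=[\![\Phi]\!]_V])[\Delta']$. Sequent $S\vdash_\Delta\Phi$: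 $S\subseteq\mathcal{S}$, $\Phi$ positive normal form, each $U\in\mathrm{dom}\Delta$ positive and unbound in $\Phi$. Rules: ($\wedge$) $S\vdash_\Delta\Phi_1\wedge\Phi_2$ from $S\vdash_\Delta\Phi_1,S\vdash_\Delta\Phi_2$; ($\vee$) $S\vdash_\Delta\Phi_1\vee\Phi_2$ from $S_1\vdash_\Delta\Phi_1,S_2\vdash_\Delta\Phi_2$, $S=S_1\cup S_2$; ($[K]$) $S\vdash_\Delta[K]\Phi$ from $\{s'\mid\exists s\in S.s\xrightarrow{K}s'\}\vdash_\Delta\Phi$; ($\langle K\rangle,f$) $S\vdash_\Delta\langle K\rangle\Phi$ from $f(S)\vdash_\Delta\Phi$ with $f\colon S\to\mathcal{S}$, $s\xrightarrow{K}f(s)$; ($\sigma Z$) $S\vdash_\Delta\sigma Z.\Phi$ from $S\vdash_{\Delta\cdot(U=\sigma Z.\Phi)}U$, $U$ fresh; (Un) $S\vdash_\Delta U$ from $S\vdash_\Delta\Phi[Z:=U]$, $\Delta(U)=\sigma Z.\Phi$; (Thin) $S\vdash_\Delta\Phi$ from $S'\vdash_\Delta\Phi$, $S\subseteq S'$. A partial tableau: finite ordered tree with sequent-labeled nodes, internal nodes labeled by rule applications consistent with node/children sequents. Tableau: root has empty definition list and every leaf $\mathbf{n}$ is terminal: formula $Z$ or $\neg Z$ with $Z\notin\mathrm{dom}(dl(\mathbf{n}))$ (free leaf); formula $\langle K\rangle\Psi$ with some state of $\mathbf{n}$ having no $K$-successor (diamond leaf); or formula $U\in\mathrm{dom}(dl(\mathbf{n}))$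 with a strict ancestor having formula $U$ and a superset of $\mathbf{n}$'s states ($\sigma$-leaf; $\mu$-/$\nu$-leaf by the type of $dl(\mathbf{n})(U)$). Companion nodes: nodes with rule Un; companion leaves of $\mathbf{m}$: leaves strictly below $\mathbf{m}$ with the same formula and a subset of its states, not companion leaves of a companion node strictly below $\mathbf{m}$. Dependencies: for child $\mathbf{n}'$ of $\mathbf{n}$, $s'<_{\mathbf{n}',\mathbf{n}}s$ iff $s'\in st(\mathbf{n}'),s\in st(\mathbf{n})$ and ($[K]$ at $\mathbf{n}$ and $s\xrightarrow{K}s'$) or ($(\langle K\rangle,f)$ and $s'=f(s)$) or (other rule and $s'=s$); $\lessdot_{\mathbf{n}',\mathbf{n}}$ least with $s\lessdot_{\mathbf{n},\mathbf{n}}s$ and closed under $s'\lessdot_{\mathbf{n}',\mathbf{m}}s''<_{\mathbf{m},\mathbf{n}}s\Rightarrow s'\lessdot_{\mathbf{n}',\mathbf{n}}s$; $<:_{\mathbf{n}',\mathbf{n}}$, $<:_{\mathbf{m}}$ least with: $s'<:_{\mathbf{m}}s$ iff $s'<:_{\mathbf{m}',\mathbf{m}}s$ and $s'\in st(\mathbf{m}')$ for some companion leaf $\mathbf{m}'$ of $\mathbf{m}$; $s'<:_{\mathbf{n}',\mathbf{n}}s$ iff $s'\lessdot_{\mathbf{n}',\mathbf{n}}s$, or for a companion node $\mathbf{m}\ne\mathbf{n},\mathbf{n}'$ and $t,t'\in st(\mathbf{m})$: $s'<:_{\mathbf{n}',\mathbf{m}}t'$, $t'(<:_{\mathbf{m}})^+t$,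 $t\lessdot_{\mathbf{m},\mathbf{n}}s$. Leaf successful: $Z$-free leaf with $st\subseteq V(Z)$; $\neg Z$-free leaf with $st\cap V(Z)=\emptyset$; $\nu$-leaf; $\mu$-leaf whose companion node $\mathbf{m}$ has $<:_{\mathbf{m}}$ well-founded. Successful tableau: all leaves successful. Tableau normal form (TNF): (i) thinning-restricted: the root's rule is not Thin, and for every non-root node $\mathbf{n}$, the rule at $\mathbf{n}$ is $\sigma Z$ iff the rule at its parent is Thin; (ii) unfolding-limited: for each definitional constant $U$ appearing in the tableau there is exactly one node with formula $U$ and rule Un; (iii) irredundant: for every node with rule $\vee$ and children $\mathbf{n}_1\mathbf{n}_2$, $st(\mathbf{n}_1)\cap st(\mathbf{n}_2)=\emptyset$. -}

module Defs where

open import Level using (0ℓ; Lift)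
open import Data.Nat using (ℕ; zero; suc; _≟_; _+_)
open import Data.List using (List; []; _∷_; _++_; [_]; length; map)
open import Data.List.Relation.Unary.Any using (Any)
open import Data.List.Relation.Unary.All using (All)
open import Data.Maybe using (Maybe; just; nothing)
open import Data.Product using (Σ; _×_; _,_; proj₁; proj₂)
open import Data.Sum using (_⊎_; inj₁; inj₂)
open import Data.Unit using (⊤; tt)
open import Data.Empty using (⊥; ⊥-elim)
open import Relation.Nullary using (¬_; yes; no)
open import Relation.Unary using (Pred; _⊆_; _∪_; _≐_)
open import Relation.Binary.PropositionalEquality using (_≡_; _≢_)
open import Induction.WellFounded using (WellFounded)

-- Variables: a countably infinite set (ℕ).  Definitional constants U are
-- also drawn from Var.

Var : Set
Var = ℕ

nth : ∀ {a} {A : Set a} → List A → ℕ → Maybe A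
nth []       _       = nothing
nth (x ∷ xs) zero    = just x
nth (x ∷ xs) (suc i) = nth xs i

module Syntax (Act : Set) where

  data Form : Set₁ where
    cvar : Var → Form
    cneg : Form → Form
    _c∧_ : Form → Form → Form
    cbox : Pred Act 0ℓ → Form → Form
    cnu  : Var → Form → Form

  negSub : Var → Form → Form
  negSub Z (cvar Y) with Y ≟ Z
  ... | yes _ = cneg (cvar Y)
  ... | no  _ = cvar Y
  negSub Z (cneg φ)   = cneg (negSub Z φ)
  negSub Z (φ c∧ ψ)   = negSub Z φ c∧ negSub Z ψ
  negSub Z (cbox K φ) = cbox K (negSub Z φ)
  negSub Z (cnu Y φ) with Y ≟ Z
  ... | yes _ = cnu Y φ
  ... | no  _ = cnu Y (negSub Z φ)

  _c∨_ : Form → Form → Form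
  φ c∨ ψ = cneg (cneg φ c∧ cneg ψ)

  cdia : Pred Act 0ℓ → Form → Form
  cdia K φ = cneg (cbox K (cneg φ))

  cmu : Var → Form → Form
  cmu Z φ = cneg (cnu Z (cneg (negSub Z φ)))

  data PForm : Set₁ where
    var  : Var → PForm
    nvar : Var → PForm
    _∧_  : PForm → PForm → PForm
    _∨_  : PForm → PForm → PForm
    box  : Pred Act 0ℓ → PForm → PForm
    dia  : Pred Act 0ℓ → PForm → PForm
    nu   : Var → PForm → PForm
    mu   : Var → PForm → PForm

  ⌜_⌝ : PForm → Form
  ⌜ var Z ⌝   = cvar Z
  ⌜ nvar Z ⌝  = cneg (cvar Z)
  ⌜ φ ∧ ψ ⌝   = ⌜ φ ⌝ c∧ ⌜ ψ ⌝
  ⌜ φ ∨ ψ ⌝   = ⌜ φ ⌝ c∨ ⌜ ψ ⌝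
  ⌜ box K φ ⌝ = cbox K ⌜ φ ⌝
  ⌜ dia K φ ⌝ = cdia K ⌜ φ ⌝
  ⌜ nu Z φ ⌝  = cnu Z ⌜ φ ⌝
  ⌜ mu Z φ ⌝  = cmu Z ⌜ φ ⌝

  FixFree : PForm → Set
  FixFree (var _)   = ⊤
  FixFree (nvar _)  = ⊤
  FixFree (φ ∧ ψ)   = FixFree φ × FixFree ψ
  FixFree (φ ∨ ψ)   = FixFree φ × FixFree ψ
  FixFree (box _ φ) = FixFree φ
  FixFree (dia _ φ) = FixFree φ
  FixFree (nu _ _)  = ⊥
  FixFree (mu _ _)  = ⊥

  NoNu : Form → Set
  NoNu (cvar _)   = ⊤
  NoNu (cneg φ)   = NoNu φ
  NoNu (φ c∧ ψ)   = NoNu φ × NoNu ψ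
  NoNu (cbox _ φ) = NoNu φ
  NoNu (cnu _ _)  = ⊥

  fixFree⇒NoNu : (Φ : PForm) → FixFree Φ → NoNu ⌜ Φ ⌝
  fixFree⇒NoNu (var _)   _       = tt
  fixFree⇒NoNu (nvar _)  _       = tt
  fixFree⇒NoNu (φ ∧ ψ)   (p , q) = fixFree⇒NoNu φ p , fixFree⇒NoNu ψ q
  fixFree⇒NoNu (φ ∨ ψ)   (p , q) = fixFree⇒NoNu φ p , fixFree⇒NoNu ψ q
  fixFree⇒NoNu (box _ φ) p       = fixFree⇒NoNu φ p
  fixFree⇒NoNu (dia _ φ) p       = fixFree⇒NoNu φ p
  fixFree⇒NoNu (nu _ _)  ()
  fixFree⇒NoNu (mu _ _)  ()

  FreeIn : Var → PForm → Set
  FreeIn U (var Z)   = U ≡ Z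
  FreeIn U (nvar Z)  = U ≡ Z
  FreeIn U (φ ∧ ψ)   = FreeIn U φ ⊎ FreeIn U ψ
  FreeIn U (φ ∨ ψ)   = FreeIn U φ ⊎ FreeIn U ψ
  FreeIn U (box _ φ) = FreeIn U φ
  FreeIn U (dia _ φ) = FreeIn U φ
  FreeIn U (nu Z φ)  = U ≢ Z × FreeIn U φ
  FreeIn U (mu Z φ)  = U ≢ Z × FreeIn U φ

  NegFree : Var → PForm → Set
  NegFree U (var Z)   = ⊥
  NegFree U (nvar Z)  = U ≡ Z
  NegFree U (φ ∧ ψ)   = NegFree U φ ⊎ NegFree U ψ
  NegFree U (φ ∨ ψ)   = NegFree U φ ⊎ NegFree U ψ
  NegFree U (box _ φ) = NegFree U φ
  NegFree U (dia _ φ) = NegFree U φ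
  NegFree U (nu Z φ)  = U ≢ Z × NegFree U φ
  NegFree U (mu Z φ)  = U ≢ Z × NegFree U φ

  Bound : Var → PForm → Set
  Bound U (var Z)   = ⊥
  Bound U (nvar Z)  = ⊥
  Bound U (φ ∧ ψ)   = Bound U φ ⊎ Bound U ψ
  Bound U (φ ∨ ψ)   = Bound U φ ⊎ Bound U ψ
  Bound U (box _ φ) = Bound U φ
  Bound U (dia _ φ) = Bound U φ
  Bound U (nu Z φ)  = U ≡ Z ⊎ Bound U φ
  Bound U (mu Z φ)  = U ≡ Z ⊎ Bound U φ

  Occurs : Var → PForm → Set
  Occurs U (var Z)   = U ≡ Z
  Occurs U (nvar Z)  = U ≡ Z
  Occurs U (φ ∧ ψ)   = Occurs U φ ⊎ Occurs U ψ
  Occurs U (φ ∨ ψ)   = Occurs U φ ⊎ Occurs U ψ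
  Occurs U (box _ φ) = Occurs U φ
  Occurs U (dia _ φ) = Occurs U φ
  Occurs U (nu Z φ)  = U ≡ Z ⊎ Occurs U φ
  Occurs U (mu Z φ)  = U ≡ Z ⊎ Occurs U φ

  -- bound variables positive (in PNF: a bound Z never occurs free as ¬Z
  -- in the body of its binder)
  BoundPos : PForm → Set
  BoundPos (var _)   = ⊤
  BoundPos (nvar _)  = ⊤
  BoundPos (φ ∧ ψ)   = BoundPos φ × BoundPos ψ
  BoundPos (φ ∨ ψ)   = BoundPos φ × BoundPos ψ
  BoundPos (box _ φ) = BoundPos φ
  BoundPos (dia _ φ) = BoundPos φ
  BoundPos (nu Z φ)  = ¬ NegFree Z φ × BoundPos φ
  BoundPos (mu Z φ)  = ¬ NegFree Z φ × BoundPos φ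

  _[_≔_] : PForm → Var → Var → PForm
  var Y [ Z ≔ U ] with Y ≟ Z
  ... | yes _ = var U
  ... | no  _ = var Y
  nvar Y [ Z ≔ U ] with Y ≟ Z
  ... | yes _ = nvar U
  ... | no  _ = nvar Y
  (φ ∧ ψ) [ Z ≔ U ]   = (φ [ Z ≔ U ]) ∧ (ψ [ Z ≔ U ])
  (φ ∨ ψ) [ Z ≔ U ]   = (φ [ Z ≔ U ]) ∨ (ψ [ Z ≔ U ])
  box K φ [ Z ≔ U ]   = box K (φ [ Z ≔ U ])
  dia K φ [ Z ≔ U ]   = dia K (φ [ Z ≔ U ])
  nu Y φ [ Z ≔ U ] with Y ≟ Z
  ... | yes _ = nu Y φ
  ... | no  _ = nu Y (φ [ Z ≔ U ])
  mu Y φ [ Z ≔ U ] with Y ≟ Z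
  ... | yes _ = mu Y φ
  ... | no  _ = mu Y (φ [ Z ≔ U ])

  -- definition lists (U₁ = Φ₁) ⋯ (Uₙ = Φₙ), leftmost first
  DefList : Set₁
  DefList = List (Var × PForm)

  InDom : Var → DefList → Set
  InDom U Δ = Any (U ≡_) (map proj₁ Δ)

  lookupDL : Var → DefList → Maybe PForm
  lookupDL U []            = nothing
  lookupDL U ((V , φ) ∷ Δ) with U ≟ V
  ... | yes _ = just φ
  ... | no  _ = lookupDL U Δ

  IsDefList : DefList → Set₁
  IsDefList []            = Lift _ ⊤
  IsDefList ((U , φ) ∷ Δ) =
      ¬ InDom U Δ
    × (∀ U′ → InDom U′ ((U , φ) ∷ Δ) → ¬ Bound U′ φ)
    × All (λ p → ¬ Bound U (proj₂ p)) Δ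
    × (∀ U′ → InDom U′ ((U , φ) ∷ Δ) → ¬ FreeIn U′ φ)
    × IsDefList Δ

  IsFixpoint : PForm → Set₁
  IsFixpoint Φ = Σ Var (λ Z → Σ PForm (λ Ψ → Φ ≡ nu Z Ψ ⊎ Φ ≡ mu Z Ψ))

module LTS (Act : Set) (𝒮 : Set) (Tr : 𝒮 → Act → 𝒮 → Set) where

  open Syntax Act public

  Step : 𝒮 → Pred Act 0ℓ → 𝒮 → Set
  Step s K s′ = Σ Act (λ a → K a × Tr s a s′)

  Valuation : Set₁
  Valuation = Var → Pred 𝒮 0ℓ

  -- standard semantics, on ν-free core formulas (all that is needed for
  -- fixpoint-free formulas)
  ⟦_⟧ : (φ : Form) → NoNu φ → Valuation → Pred 𝒮 0ℓ
  ⟦ cvar Z ⟧   _       V s = V Z s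
  ⟦ cneg φ ⟧   p       V s = ¬ ⟦ φ ⟧ p V s
  ⟦ φ c∧ ψ ⟧   (p , q) V s = ⟦ φ ⟧ p V s × ⟦ ψ ⟧ q V s
  ⟦ cbox K φ ⟧ p       V s = ∀ s′ → Step s K s′ → ⟦ φ ⟧ p V s′
  ⟦ cnu _ _ ⟧  ()      V s

  record Seq : Set₁ where
    constructor _⊢[_]_
    field
      st : Pred 𝒮 0ℓ
      dl : DefList
      fm : PForm
  open Seq public

  IsSequent : Seq → Set₁
  IsSequent σ =
      BoundPos (fm σ)
    × IsDefList (dl σ)
    × (∀ U → InDom U (dl σ) → ¬ NegFree U (fm σ) × ¬ Bound U (fm σ))

  data Rule (S : Pred 𝒮 0ℓ) : Set where
    R∧ R∨ R[] RUn RThin : Rule S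
    R⟨⟩ : (f : (s : 𝒮) → S s → 𝒮) → Rule S
    Rσ  : Var → Rule S

  data Tree : Set₁ where
    leaf : Seq → Tree
    node : (σ : Seq) → Rule (st σ) → List Tree → Tree

  lbl : Tree → Seq
  lbl (leaf σ)       = σ
  lbl (node σ _ _)   = σ

  Fresh : Var → Seq → Set₁
  Fresh U σ = ¬ InDom U (dl σ) × ¬ Occurs U (fm σ)
            × All (λ p → ¬ Occurs U (proj₂ p)) (dl σ)

  Consistent : (σ : Seq) → Rule (st σ) → List Tree → Set₁
  Consistent σ R∧ (c₁ ∷ c₂ ∷ []) =
    Σ PForm λ A → Σ PForm λ B → fm σ ≡ (A ∧ B)
      × st (lbl c₁) ≐ st σ × dl (lbl c₁) ≡ dl σ × fm (lbl c₁) ≡ A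
      × st (lbl c₂) ≐ st σ × dl (lbl c₂) ≡ dl σ × fm (lbl c₂) ≡ B
  Consistent σ R∨ (c₁ ∷ c₂ ∷ []) =
    Σ PForm λ A → Σ PForm λ B → fm σ ≡ (A ∨ B)
      × st σ ≐ (st (lbl c₁) ∪ st (lbl c₂))
      × dl (lbl c₁) ≡ dl σ × fm (lbl c₁) ≡ A
      × dl (lbl c₂) ≡ dl σ × fm (lbl c₂) ≡ B
  Consistent σ R[] (c ∷ []) =
    Σ (Pred Act 0ℓ) λ K → Σ PForm λ A → fm σ ≡ box K A
      × st (lbl c) ≐ (λ s′ → Σ 𝒮 λ s → st σ s × Step s K s′)
      × dl (lbl c) ≡ dl σ × fm (lbl c) ≡ A
  Consistent σ (R⟨⟩ f) (c ∷ []) =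
    Σ (Pred Act 0ℓ) λ K → Σ PForm λ A → fm σ ≡ dia K A
      × (∀ s (p : st σ s) → Step s K (f s p))
      × st (lbl c) ≐ (λ s′ → Σ 𝒮 λ s → Σ (st σ s) λ p → s′ ≡ f s p)
      × dl (lbl c) ≡ dl σ × fm (lbl c) ≡ A
  Consistent σ (Rσ U) (c ∷ []) =
    IsFixpoint (fm σ) × Fresh U σ
      × st (lbl c) ≐ st σ
      × dl (lbl c) ≡ dl σ ++ [ (U , fm σ) ]
      × fm (lbl c) ≡ var U
  Consistent σ RUn (c ∷ []) =
    Σ Var λ U → Σ Var λ Z → Σ PForm λ A → fm σ ≡ var U
      × (lookupDL U (dl σ) ≡ just (nu Z A) ⊎ lookupDL U (dl σ) ≡ just (mu Z A))
      × st (lbl c) ≐ st σ × dl (lbl c) ≡ dl σ × fm (lbl c) ≡ (A [ Z ≔ U ])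
  Consistent σ RThin (c ∷ []) =
    st σ ⊆ st (lbl c) × dl (lbl c) ≡ dl σ × fm (lbl c) ≡ fm σ
  Consistent σ _ _ = Lift _ ⊥

  mutual
    PartialTableau : Tree → Set₁
    PartialTableau (leaf σ)        = IsSequent σ
    PartialTableau (node σ r cs)   = IsSequent σ × Consistent σ r cs × PartialTableaux cs

    PartialTableaux : List Tree → Set₁
    PartialTableaux []       = Lift _ ⊤
    PartialTableaux (c ∷ cs) = PartialTableau c × PartialTableaux cs

  -- nodes are addressed by paths (lists of child indices) from the root
  Path : Set
  Path = List ℕ

  sub : Tree → Path → Maybe Tree
  sub t [] = just t
  sub (leaf _) (i ∷ p) = nothing
  sub (node _ _ cs) (i ∷ p) with nth cs i
  ... | just c  = sub c p
  ... | nothing = nothing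

  isThin : Tree → Set
  isThin (node _ RThin _) = ⊤
  isThin _                = ⊥

  isSigma : Tree → Set
  isSigma (node _ (Rσ _) _) = ⊤
  isSigma _                 = ⊥

  module InTree (T : Tree) where

    StrictAnc : Path → Path → Set
    StrictAnc m n = Σ ℕ λ i → Σ Path λ p → n ≡ m ++ (i ∷ p)

    IsLeaf : Path → Set₁
    IsLeaf n = Σ Seq λ σ → sub T n ≡ just (leaf σ)

    StAt : Path → 𝒮 → Set₁
    StAt n s = Σ Tree λ t → sub T n ≡ just t × st (lbl t) s

    CompNode : Path → Set₁
    CompNode m = Σ Seq λ σ → Σ (List Tree) λ cs → sub T m ≡ just (node σ RUn cs)

    CLBase : Path → Path → Set₁
    CLBase m n = CompNode m × StrictAnc m n
      × Σ Tree (λ t → sub T m ≡ just t × Σ Seq λ σ → sub T n ≡ just (leaf σ)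
                 × fm σ ≡ fm (lbl t) × st σ ⊆ st (lbl t))

    -- companion leaves, with depth difference (length n - length m) ≤ k
    CL≤ : ℕ → Path → Path → Set₁
    CL≤ zero    m n = Lift _ ⊥
    CL≤ (suc k) m n = CL≤ k m n
      ⊎ (length n ≡ suc k + length m × CLBase m n
          × (∀ m″ → CompNode m″ → StrictAnc m m″ → ¬ CL≤ k m″ n))

    CompLeaf : Path → Path → Set₁
    CompLeaf m n = CL≤ (length n) m n

    RDep : (σ : Seq) → Rule (st σ) → 𝒮 → 𝒮 → Set₁
    RDep σ R[] s s′ = Σ (Pred Act 0ℓ) λ K → Σ PForm λ A → fm σ ≡ box K A × Step s K s′
    RDep σ (R⟨⟩ f) s s′ = Lift _ (Σ (st σ s) λ p → s′ ≡ f s p)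
    RDep σ R∧ s s′ = Lift _ (s′ ≡ s)
    RDep σ R∨ s s′ = Lift _ (s′ ≡ s)
    RDep σ RUn s s′ = Lift _ (s′ ≡ s)
    RDep σ RThin s s′ = Lift _ (s′ ≡ s)
    RDep σ (Rσ _) s s′ = Lift _ (s′ ≡ s)

    Dep : Path → 𝒮 → Path → 𝒮 → Set₁
    Dep n′ s′ n s = Σ ℕ λ i → n′ ≡ n ++ [ i ]
      × Σ Seq (λ σ → Σ (Rule (st σ)) λ r → Σ (List Tree) λ cs →
          sub T n ≡ just (node σ r cs) × st σ s × RDep σ r s s′)
      × StAt n′ s′

    data Dot : Path → 𝒮 → Path → 𝒮 → Set₁ where
      base : ∀ n s → Dot n s n s
      step : ∀ {n′ s′ m s″ n s} → Dot n′ s′ m s″ → Dep m s″ n s → Dot n′ s′ n s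

    mutual
      data LtM (m : Path) : 𝒮 → 𝒮 → Set₁ where
        viaLeaf : ∀ {m′ s′ s} → CompLeaf m m′ → StAt m′ s′ → LtC m′ s′ m s → LtM m s′ s

      data LtC : Path → 𝒮 → Path → 𝒮 → Set₁ where
        dot : ∀ {n′ s′ n s} → Dot n′ s′ n s → LtC n′ s′ n s
        viaComp : ∀ {n′ s′ n s} m {t t′} → CompNode m → m ≢ n → m ≢ n′
                → StAt m t → StAt m t′
                → LtC n′ s′ m t′ → LtM⁺ m t′ t → Dot m t n s → LtC n′ s′ n s

      data LtM⁺ (m : Path) : 𝒮 → 𝒮 → Set₁ where
        one  : ∀ {x y} → LtM m x y → LtM⁺ m x y
        more : ∀ {x z y} → LtM m x z → LtM⁺ m z y → LtM⁺ m x y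

    SigmaLeaf : Path → Seq → Var → Set₁
    SigmaLeaf n σ U = fm σ ≡ var U × InDom U (dl σ)
      × Σ Path λ m → StrictAnc m n × Σ Tree λ t → sub T m ≡ just t
          × fm (lbl t) ≡ var U × st σ ⊆ st (lbl t)

    Terminal : Path → Set₁
    Terminal n = Σ Seq λ σ → sub T n ≡ just (leaf σ) ×
      ( (Σ Var λ Z → (fm σ ≡ var Z ⊎ fm σ ≡ nvar Z) × ¬ InDom Z (dl σ))
      ⊎ (Σ (Pred Act 0ℓ) λ K → Σ PForm λ A → fm σ ≡ dia K A
           × Σ 𝒮 λ s → st σ s × ¬ (Σ 𝒮 λ s′ → Step s K s′))
      ⊎ (Σ Var λ U → SigmaLeaf n σ U))

    SuccessfulLeaf : Valuation → Path → Set₁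
    SuccessfulLeaf V n = Σ Seq λ σ → sub T n ≡ just (leaf σ) ×
      ( (Σ Var λ Z → fm σ ≡ var Z × ¬ InDom Z (dl σ) × st σ ⊆ V Z)
      ⊎ (Σ Var λ Z → fm σ ≡ nvar Z × ¬ InDom Z (dl σ) × (∀ s → st σ s → ¬ V Z s))
      ⊎ (Σ Var λ U → SigmaLeaf n σ U
           × Σ Var λ Z → Σ PForm λ A → lookupDL U (dl σ) ≡ just (nu Z A))
      ⊎ (Σ Var λ U → SigmaLeaf n σ U
           × (Σ Var λ Z → Σ PForm λ A → lookupDL U (dl σ) ≡ just (mu Z A))
           × Σ Path λ m → CompLeaf m n × WellFounded (LtM m)))

    UnNode : Path → Var → Set₁
    UnNode n U = Σ Seq λ σ → Σ (List Tree) λ cs →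
      sub T n ≡ just (node σ RUn cs) × fm σ ≡ var U

  open InTree public

  Tableau : Tree → Set₁
  Tableau T = PartialTableau T × dl (lbl T) ≡ []
            × (∀ n → IsLeaf T n → Terminal T n)

  Successful : Valuation → Tree → Set₁
  Successful V T = ∀ n → IsLeaf T n → SuccessfulLeaf T V n

  ThinningRestricted : Tree → Set₁
  ThinningRestricted T = ¬ isThin T
    × (∀ n i t t′ → sub T n ≡ just t → sub T (n ++ [ i ]) ≡ just t′
         → (isSigma t′ → isThin t) × (isThin t → isSigma t′))

  UnfoldingLimited : Tree → Set₁
  UnfoldingLimited T = ∀ U →
    (Σ Path λ n → Σ Tree λ t → sub T n ≡ just t × InDom U (dl (lbl t)))
    → Σ Path λ n → UnNode T n U × (∀ n′ → UnNode T n′ U → n′ ≡ n)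

  Irredundant : Tree → Set₁
  Irredundant T = ∀ n σ cs c₁ c₂ → sub T n ≡ just (node σ R∨ cs) → cs ≡ c₁ ∷ c₂ ∷ []
    → ∀ s → st (lbl c₁) s → st (lbl c₂) s → ⊥

  TNF : Tree → Set₁
  TNF T = ThinningRestricted T × UnfoldingLimited T × Irredundant T

{-# OPTIONS --safe #-}
-- For a fixpoint-free formula the tableau is built by structural recursion
-- on the formula, using only the rules (∧), (∨), ([K]) and (⟨K⟩,f).  At a
-- disjunction the states are split into those satisfying the left disjunct
-- and the rest, which makes the tree irredundant; at a diamond every state
-- is sent to a K-successor satisfying the body, chosen by excluded middle.
-- No definitional constant is ever introduced, so the definition lists stay
-- empty, every leaf is a free leaf satisfied by V, and the normal-form
-- conditions hold vacuously.
module Submission where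

open import Defs
open import Level using (0ℓ; suc; Lift; lift; lower)
open import Data.List using ([]; List; _∷_; _++_; [_])
open import Data.Product using (Σ; _×_; _,_; proj₁; proj₂)
open import Data.Sum using (_⊎_; inj₁; inj₂)
open import Data.Unit using (⊤; tt)
open import Data.Empty using (⊥; ⊥-elim)
open import Data.Maybe using (just; nothing)
import Data.Nat as ℕ
open import Function using (id)
open import Relation.Nullary using (¬_; Dec; yes; no)
open import Relation.Nullary.Decidable using (map′; decidable-stable)
open import Relation.Unary using (Pred; _⊆_; _≐_; _∩_; ∁)
open import Relation.Binary.PropositionalEquality using (_≡_; refl; cong)
open import Axiom.ExcludedMiddle using (ExcludedMiddle)

module _ {Act : Set} where
  open Syntax Act

  fixFree⇒boundPos : ∀ Φ → FixFree Φ → BoundPos Φ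
  fixFree⇒boundPos (var _)   _       = tt
  fixFree⇒boundPos (nvar _)  _       = tt
  fixFree⇒boundPos (φ ∧ ψ)   (p , q) = fixFree⇒boundPos φ p , fixFree⇒boundPos ψ q
  fixFree⇒boundPos (φ ∨ ψ)   (p , q) = fixFree⇒boundPos φ p , fixFree⇒boundPos ψ q
  fixFree⇒boundPos (box _ φ) p       = fixFree⇒boundPos φ p
  fixFree⇒boundPos (dia _ φ) p       = fixFree⇒boundPos φ p

module Elementary (Act : Set) (𝒮 : Set) (Tr : 𝒮 → Act → 𝒮 → Set) (V : LTS.Valuation Act 𝒮 Tr) where
  open LTS Act 𝒮 Tr

  fixFree⇒isSequent : ∀ S Φ → FixFree Φ → IsSequent (S ⊢[ [] ] Φ)
  fixFree⇒isSequent S Φ ff = fixFree⇒boundPos Φ ff , _ , λ _ ()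

  ≡⇒st≐ : ∀ {σ τ} → σ ≡ τ → st σ ≐ st τ
  ≡⇒st≐ refl = id , id

  []-notInDom : ∀ {Δ : DefList} {U} → Δ ≡ [] → ¬ InDom U Δ
  []-notInDom refl ()

  data LogicalRule {S : Pred 𝒮 0ℓ} : Rule S → Set where
    ∧-rule   : LogicalRule R∧
    ∨-rule   : LogicalRule R∨
    box-rule : LogicalRule R[]
    dia-rule : ∀ {f} → LogicalRule (R⟨⟩ f)

  DisjointChildren : ∀ {S} → Rule S → List Tree → Set
  DisjointChildren R∨ (c₁ ∷ c₂ ∷ []) = ∀ s → st (lbl c₁) s → st (lbl c₂) s → ⊥
  DisjointChildren _  _              = ⊤

  SatisfiedLiteral : Seq → Set₁
  SatisfiedLiteral σ = Σ Var (λ Z → fm σ ≡ var Z × st σ ⊆ V Z)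
                     ⊎ Σ Var (λ Z → fm σ ≡ nvar Z × (∀ s → st σ s → ¬ V Z s))

  mutual
    IsElementary : Tree → Set₁
    IsElementary (leaf σ)      = dl σ ≡ [] × SatisfiedLiteral σ
    IsElementary (node σ r cs) = dl σ ≡ [] × LogicalRule r × DisjointChildren r cs × AllElementary cs

    AllElementary : List Tree → Set₁
    AllElementary []       = Lift _ ⊤
    AllElementary (c ∷ cs) = IsElementary c × AllElementary cs

  nth-elementary : ∀ cs i {c} → AllElementary cs → nth cs i ≡ just c → IsElementary c
  nth-elementary (c ∷ _)  ℕ.zero   (e , _)  refl = e
  nth-elementary (_ ∷ cs) (ℕ.suc i) (_ , es) eq   = nth-elementary cs i es eq

  sub-elementary : ∀ T n {t} → IsElementary T → sub T n ≡ just t → IsElementary t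
  sub-elementary T             []      e             refl = e
  sub-elementary (leaf _)      (_ ∷ _) _             ()
  sub-elementary (node σ r cs) (i ∷ p) (_ , _ , _ , es) eq with nth cs i in eqᵢ
  ... | just c  = sub-elementary c p (nth-elementary cs i es eqᵢ) eq
  sub-elementary (node σ r cs) (i ∷ p) _ () | nothing

  elementary-root-dl : ∀ T → IsElementary T → dl (lbl T) ≡ []
  elementary-root-dl (leaf _)     (e , _) = e
  elementary-root-dl (node _ _ _) (e , _) = e

  elementary-¬thin : ∀ T → IsElementary T → ¬ isThin T
  elementary-¬thin (leaf _)     _ ()
  elementary-¬thin (node _ _ _) (_ , ∧-rule   , _) ()
  elementary-¬thin (node _ _ _) (_ , ∨-rule   , _) ()
  elementary-¬thin (node _ _ _) (_ , box-rule , _) ()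
  elementary-¬thin (node _ _ _) (_ , dia-rule , _) ()

  elementary-¬sigma : ∀ T → IsElementary T → ¬ isSigma T
  elementary-¬sigma (leaf _)     _ ()
  elementary-¬sigma (node _ _ _) (_ , ∧-rule   , _) ()
  elementary-¬sigma (node _ _ _) (_ , ∨-rule   , _) ()
  elementary-¬sigma (node _ _ _) (_ , box-rule , _) ()
  elementary-¬sigma (node _ _ _) (_ , dia-rule , _) ()

  disjoint-∨ : ∀ {S} cs {c₁ c₂} → DisjointChildren {S} R∨ cs → cs ≡ c₁ ∷ c₂ ∷ []
             → ∀ s → st (lbl c₁) s → st (lbl c₂) s → ⊥
  disjoint-∨ _ disj refl = disj

  elementary-tableau : ∀ T → PartialTableau T → IsElementary T → Tableau T
  elementary-tableau T partial e = partial , elementary-root-dl T e , terminal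
    where
    terminal : ∀ n → IsLeaf T n → Terminal T n
    terminal n (σ , at) with sub-elementary T n e at
    ... | empty , inj₁ (Z , is-var , _)  = σ , at , inj₁ (Z , inj₁ is-var , []-notInDom empty)
    ... | empty , inj₂ (Z , is-nvar , _) = σ , at , inj₁ (Z , inj₂ is-nvar , []-notInDom empty)

  elementary-TNF : ∀ T → IsElementary T → TNF T
  elementary-TNF T e = thinning-restricted , unfolding-limited , irredundant
    where
    thinning-restricted : ThinningRestricted T
    thinning-restricted = elementary-¬thin T e , λ n i t t′ at at′ →
        (λ σ-rule → ⊥-elim (elementary-¬sigma t′ (sub-elementary T (n ++ [ i ]) e at′) σ-rule))
      , (λ thin → ⊥-elim (elementary-¬thin t (sub-elementary T n e at) thin))

    unfolding-limited : UnfoldingLimited T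
    unfolding-limited U (n , t , at , U∈Δ) =
      ⊥-elim ([]-notInDom (elementary-root-dl t (sub-elementary T n e at)) U∈Δ)

    irredundant : Irredundant T
    irredundant n σ cs c₁ c₂ at children with sub-elementary T n e at
    ... | _ , _ , disj , _ = disjoint-∨ cs disj children

  elementary-successful : ∀ T → IsElementary T → Successful V T
  elementary-successful T e n (σ , at) with sub-elementary T n e at
  ... | empty , inj₁ (Z , is-var , S⊆V)  = σ , at , inj₁ (Z , is-var , []-notInDom empty , S⊆V)
  ... | empty , inj₂ (Z , is-nvar , S∩V) = σ , at , inj₂ (inj₁ (Z , is-nvar , []-notInDom empty , S∩V))

module Construction (em : ExcludedMiddle (suc 0ℓ))
  (Act : Set) (𝒮 : Set) (Tr : 𝒮 → Act → 𝒮 → Set) (V : LTS.Valuation Act 𝒮 Tr) where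
  open LTS Act 𝒮 Tr
  open Elementary Act 𝒮 Tr V

  decide : (P : Set) → Dec P
  decide P = map′ lower lift (em {Lift _ P})

  stable : {P : Set} → ¬ ¬ P → P
  stable {P} = decidable-stable (decide P)

  ⟦_⟧ᶠ : (Φ : PForm) → FixFree Φ → Pred 𝒮 0ℓ
  ⟦ Φ ⟧ᶠ ff = ⟦ ⌜ Φ ⌝ ⟧ (fixFree⇒NoNu Φ ff) V

  Post : Pred Act 0ℓ → Pred 𝒮 0ℓ → Pred 𝒮 0ℓ
  Post K S s′ = Σ 𝒮 λ s → S s × Step s K s′

  Image : (S : Pred 𝒮 0ℓ) → ((s : 𝒮) → S s → 𝒮) → Pred 𝒮 0ℓ
  Image S f s′ = Σ 𝒮 λ s → Σ (S s) λ p → s′ ≡ f s p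

  ∨-right : ∀ A B fa fb {s} → ⟦ A ∨ B ⟧ᶠ (fa , fb) s → ¬ ⟦ A ⟧ᶠ fa s → ⟦ B ⟧ᶠ fb s
  ∨-right _ _ _ _ A∨B ¬A = stable λ ¬B → A∨B (¬A , ¬B)

  dia-witness : ∀ K A ff {s} → ⟦ dia K A ⟧ᶠ ff s → Σ 𝒮 λ s′ → Step s K s′ × ⟦ A ⟧ᶠ ff s′
  dia-witness _ _ _ ◇A = stable λ none → ◇A λ s′ s→s′ A-s′ → none (s′ , s→s′ , A-s′)

  record Built (S : Pred 𝒮 0ℓ) (Φ : PForm) : Set₁ where
    field
      tree       : Tree
      partial    : PartialTableau tree
      elementary : IsElementary tree
      root       : lbl tree ≡ (S ⊢[ [] ] Φ)

    root-st : st (lbl tree) ≐ S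
    root-st = ≡⇒st≐ root

    root-dl : dl (lbl tree) ≡ []
    root-dl = cong dl root

    root-fm : fm (lbl tree) ≡ Φ
    root-fm = cong fm root

  build : ∀ S Φ ff → S ⊆ ⟦ Φ ⟧ᶠ ff → Built S Φ
  build S (var Z) ff S⊨ = record
    { tree       = leaf (S ⊢[ [] ] var Z)
    ; partial    = fixFree⇒isSequent S (var Z) ff
    ; elementary = refl , inj₁ (Z , refl , S⊨)
    ; root       = refl }
  build S (nvar Z) ff S⊨ = record
    { tree       = leaf (S ⊢[ [] ] nvar Z)
    ; partial    = fixFree⇒isSequent S (nvar Z) ff
    ; elementary = refl , inj₂ (Z , refl , λ _ → S⊨)
    ; root       = refl }
  build S (A ∧ B) ff@(fa , fb) S⊨ = record
    { tree       = node (S ⊢[ [] ] (A ∧ B)) R∧ (L.tree ∷ R.tree ∷ [])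
    ; partial    = fixFree⇒isSequent S (A ∧ B) ff
                 , (A , B , refl , L.root-st , L.root-dl , L.root-fm , R.root-st , R.root-dl , R.root-fm)
                 , L.partial , R.partial , _
    ; elementary = refl , ∧-rule , _ , L.elementary , R.elementary , _
    ; root       = refl }
    where
    module L = Built (build S A fa λ s∈S → proj₁ (S⊨ s∈S))
    module R = Built (build S B fb λ s∈S → proj₂ (S⊨ s∈S))
  build S (A ∨ B) ff@(fa , fb) S⊨ = record
    { tree       = node (S ⊢[ [] ] (A ∨ B)) R∨ (L.tree ∷ R.tree ∷ [])
    ; partial    = fixFree⇒isSequent S (A ∨ B) ff
                 , (A , B , refl , (split , merge) , L.root-dl , L.root-fm , R.root-dl , R.root-fm)
                 , L.partial , R.partial , _
    ; elementary = refl , ∨-rule , disjoint , L.elementary , R.elementary , _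
    ; root       = refl }
    where
    module L = Built (build (S ∩ ⟦ A ⟧ᶠ fa) A fa proj₂)
    module R = Built (build (S ∩ ∁ (⟦ A ⟧ᶠ fa)) B fb λ (s∈S , ¬A) → ∨-right A B fa fb (S⊨ s∈S) ¬A)

    split : S ⊆ λ s → st (lbl L.tree) s ⊎ st (lbl R.tree) s
    split {s} s∈S with decide (⟦ A ⟧ᶠ fa s)
    ... | yes A-s = inj₁ (proj₂ L.root-st (s∈S , A-s))
    ... | no ¬A-s = inj₂ (proj₂ R.root-st (s∈S , ¬A-s))

    merge : (λ s → st (lbl L.tree) s ⊎ st (lbl R.tree) s) ⊆ S
    merge (inj₁ s∈L) = proj₁ (proj₁ L.root-st s∈L)
    merge (inj₂ s∈R) = proj₁ (proj₁ R.root-st s∈R)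

    disjoint : ∀ s → st (lbl L.tree) s → st (lbl R.tree) s → ⊥
    disjoint s s∈L s∈R = proj₂ (proj₁ R.root-st s∈R) (proj₂ (proj₁ L.root-st s∈L))
  build S (box K A) ff S⊨ = record
    { tree       = node (S ⊢[ [] ] box K A) R[] (C.tree ∷ [])
    ; partial    = fixFree⇒isSequent S (box K A) ff
                 , (K , A , refl , C.root-st , C.root-dl , C.root-fm)
                 , C.partial , _
    ; elementary = refl , box-rule , _ , C.elementary , _
    ; root       = refl }
    where
    module C = Built (build (Post K S) A ff λ (s , s∈S , s→s′) → S⊨ s∈S _ s→s′)
  build S (dia K A) ff S⊨ = record
    { tree       = node (S ⊢[ [] ] dia K A) (R⟨⟩ successor) (C.tree ∷ [])
    ; partial    = fixFree⇒isSequent S (dia K A) ff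
                 , (K , A , refl , (λ s s∈S → proj₁ (proj₂ (witness s s∈S)))
                   , C.root-st , C.root-dl , C.root-fm)
                 , C.partial , _
    ; elementary = refl , dia-rule , _ , C.elementary , _
    ; root       = refl }
    where
    witness : ∀ s → S s → Σ 𝒮 λ s′ → Step s K s′ × ⟦ A ⟧ᶠ ff s′
    witness s s∈S = dia-witness K A ff (S⊨ s∈S)

    successor : (s : 𝒮) → S s → 𝒮
    successor s s∈S = proj₁ (witness s s∈S)

    successors⊨ : Image S successor ⊆ ⟦ A ⟧ᶠ ff
    successors⊨ (s , s∈S , refl) = proj₂ (proj₂ (witness s s∈S))

    module C = Built (build (Image S successor) A ff successors⊨)

lemma42 : ExcludedMiddle (suc 0ℓ)
    → (Act : Set) (𝒮 : Set) (Tr : 𝒮 → Act → 𝒮 → Set)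
    → let open LTS Act 𝒮 Tr in
      (V : Valuation) (S : Pred 𝒮 0ℓ) (Φ : PForm) (ff : FixFree Φ)
    → IsSequent (S ⊢[ [] ] Φ)
    → S ⊆ ⟦ ⌜ Φ ⌝ ⟧ (fixFree⇒NoNu Φ ff) V
    → Σ Tree λ T → Tableau T × TNF T × Successful V T × lbl T ≡ (S ⊢[ [] ] Φ)
lemma42 em Act 𝒮 Tr V S Φ ff _ S⊨ =
  tree , elementary-tableau tree partial elementary , elementary-TNF tree elementary
       , elementary-successful tree elementary , root
  where
  open Elementary Act 𝒮 Tr V
  open Construction.Built (Construction.build em Act 𝒮 Tr V S Φ ff S⊨)
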